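{- Let $G=(V,E)$ be a graph of order $n\ge 2$ and let $H$ be a graph with at least two vertices and root vertex $v$. (i) If $v$ does not belong to any $i(H)$-set, then $i(G\circ H)=n\,i(H)$. (ii) If $v$ belongs to every $i(H)$-set, then for every $i(H)$-set $S$, $$i(G\circ H)\le \alpha(G)\,i(H)+(n-\alpha(G))\big(|pn[v,S]|+i(H)-1\big).$$
   Context: All graphs are finite, simple and undirected. An independent dominating set is a set of vertices that induces no edges and such that every vertex outside it has a neighbor in it; $i(G)$ is the minimum cardinality of such a set, and an $i(G)$-set is an independent dominating set of cardinality $i(G)$. $\alpha(G)$ is the maximum cardinality of an independent set. $N[x]$ is the closed neighborhood of $x$, and for a set $X$, $N[X]=\bigcup_{x\in X}N[x]$. For a set $D$ and $v\in D$, the private neighbor set of $v$ with respect to $D$ is $pn[v,D]=N[v]-N[D-\{v\}]$. For $G$ with vertex set $\{v_1,\dots,v_n\}$ and $H$ with root $v$, the rooted product $G\circ H$ is obtained from one copy of $G$ and $n$ copies $H_1,\dots,H_n$ of $H$ by identifying each $v_i$ with the copy of $v$ in $H_i$. -}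

module Defs where

open import Data.Nat using (ℕ; _≤_; _*_)
open import Data.Fin using (Fin; remQuot)
open import Data.Fin.Subset using (Subset; _∈_; _∉_; ∣_∣)
open import Data.Product using (Σ; ∃; _×_; _,_; proj₁; proj₂)
open import Data.Sum using (_⊎_; inj₁; inj₂)
open import Relation.Nullary using (¬_)
open import Relation.Binary.PropositionalEquality using (_≡_; refl)
import Relation.Binary.PropositionalEquality
open import Function.Bundles using (_⇔_)
open import Level using (0ℓ)

record Graph (n : ℕ) : Set₁ where
  field
    Adj    : Fin n → Fin n → Set
    adjSym : ∀ {x y} → Adj x y → Adj y x
    adjIrrefl : ∀ {x} → ¬ Adj x x
open Graph public

module _ {n : ℕ} (G : Graph n) where

  InClosedNbhd : Fin n → Fin n → Set
  InClosedNbhd x u = (u ≡ x) ⊎ Adj G x u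

  Independent : Subset n → Set
  Independent S = ∀ x y → x ∈ S → y ∈ S → ¬ Adj G x y

  Dominating : Subset n → Set
  Dominating S = ∀ x → x ∉ S → Σ (Fin n) λ y → (y ∈ S) × Adj G x y

  IsIDS : Subset n → Set
  IsIDS S = Independent S × Dominating S

  IsIndepDomNumber : ℕ → Set
  IsIndepDomNumber k = (Σ (Subset n) λ S → IsIDS S × (∣ S ∣ ≡ k))
                     × (∀ S → IsIDS S → k ≤ ∣ S ∣)

  IsISet : ℕ → Subset n → Set
  IsISet k S = IsIDS S × (∣ S ∣ ≡ k)

  IsIndepNumber : ℕ → Set
  IsIndepNumber a = (Σ (Subset n) λ S → Independent S × (∣ S ∣ ≡ a))
                  × (∀ S → Independent S → ∣ S ∣ ≤ a)

  IsPrivateNbhdSet : Fin n → Subset n → Subset n → Set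
  IsPrivateNbhdSet v S P =
    ∀ u → (u ∈ P) ⇔ (InClosedNbhd v u ×
                      (∀ w → w ∈ S → ¬ (w ≡ v) → ¬ InClosedNbhd w u))

-- Rooted product G ∘ H: vertex (i , x) ∈ Fin n × Fin m is encoded as
-- combine i x : Fin (n * m); the vertex (i , v) of copy H_i is identified
-- with vertex v_i of G.
RPAdj : ∀ {n m} → Graph n → Graph m → Fin m → Fin (n * m) → Fin (n * m) → Set
RPAdj {n} {m} G H v p q =
  let ix = remQuot {n} m p ; jy = remQuot {n} m q in
  ((proj₁ ix ≡ proj₁ jy) × Adj H (proj₂ ix) (proj₂ jy))
  ⊎ ((proj₂ ix ≡ v) × (proj₂ jy ≡ v) × Adj G (proj₁ ix) (proj₁ jy))

rootedProduct : ∀ {n m} → Graph n → (H : Graph m) → Fin m → Graph (n * m)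
rootedProduct G H v = record
  { Adj = RPAdj G H v
  ; adjSym = λ { (inj₁ (e , a)) → inj₁ (Relation.Binary.PropositionalEquality.sym e , Graph.adjSym H a)
            ; (inj₂ (e1 , e2 , a)) → inj₂ (e2 , e1 , Graph.adjSym G a) }
  ; adjIrrefl = λ { (inj₁ (_ , a)) → Graph.adjIrrefl H a
               ; (inj₂ (_ , _ , a)) → Graph.adjIrrefl G a } }

module Submission where

-- A vertex (i , x) of G ∘ H (copy i of H, vertex x) is encoded as combine i x, so a
-- subset of V(G ∘ H) is the concatenation of n "slices" D₁ … Dₙ ⊆ V(H) and
-- |D| = Σᵢ |Dᵢ|.  Inside a slice the edges are those of H; between slices only the
-- roots (i , v) and (j , v) can be adjacent, namely when i j is an edge of G.
--
-- (i) If v lies in no i(H)-set, n copies of an i(H)-set S₀ (which avoids v) form an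
--     independent dominating set (IDS) of G ∘ H.  Conversely every slice Dᵢ of an IDS D
--     is independent and dominates every vertex of Hᵢ except possibly v; so either Dᵢ is
--     an IDS of H, or Dᵢ ∪ {v} is an IDS of H containing v, hence larger than i(H).
--     Either way |Dᵢ| ≥ i(H), and |D| ≥ n i(H).
-- (ii) Let A be a maximum independent set of G (it dominates G), and let I be a maximal
--     independent subset of pn[v,S] - v.  Put S in the copies indexed by A and
--     (S - v) ∪ I in the others: this is an IDS of G ∘ H of the required size.
--
-- Adjacency is not assumed decidable, but all the conclusions we argue classically about
-- are decidable, and decidability of the finitely many adjacencies holds up to double
-- negation.

open import Defs
open import Data.Nat using (ℕ; zero; suc; _*_; _+_; _∸_; _≤_; _<_; z≤n; s≤s; _≤?_)
import Data.Nat.Properties as ℕₚ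
open import Data.Bool using (Bool; true; false; if_then_else_)
open import Data.Fin using (Fin; zero; suc; combine; remQuot)
open import Data.Fin.Properties using (remQuot-combine; combine-remQuot; any?; _≟_)
open import Data.Fin.Subset using (Subset; _∈_; _∉_; ∣_∣; _∪_; _-_; ⁅_⁆; ∁; _⊆_; inside; outside)
  renaming (⊥ to ∅)
open import Data.Fin.Subset.Properties
  using ( _∈?_; x∈p∪q⁻; p⊆p∪q; q⊆p∪q; x∈⁅x⁆; x∈⁅y⁆⇒x≡y; ∪-identityʳ; p─q⊆p; ∉⊥
        ; x∈p∧x≢y⇒x∈p-y; x∈p⇒∣p-x∣<∣p∣; ∣∁p∣≡n∸∣p∣; p⊆q⇒∣p∣≤∣q∣ )
open import Data.Vec using (Vec; []; _∷_; here; there; _++_; concat; tabulate; lookup; sum)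
open import Data.Vec.Properties
  using ( []=⇒lookup; lookup⇒[]=; lookup∘tabulate; tabulate∘lookup; tabulate-cong
        ; lookup-++ˡ; lookup-++ʳ )
import Data.List as L using (List; []; _∷_; allFin)
open import Data.List.Membership.Propositional using () renaming (_∈_ to _∈ᴸ_)
open import Data.List.Membership.Propositional.Properties using (∈-allFin)
import Data.List.Relation.Unary.Any as Any
open import Data.Product using (Σ; _×_; _,_; proj₁; proj₂)
open import Data.Sum using (_⊎_; inj₁; inj₂; [_,_]′)
open import Function using (id)
open import Data.Empty using (⊥-elim)
open import Relation.Nullary using (¬_; Dec; yes; no)
open import Relation.Nullary.Decidable using (_×-dec_; _⊎-dec_; decidable-stable; ¬¬-excluded-middle)
open import Relation.Binary.PropositionalEquality
  using (_≡_; _≢_; refl; sym; trans; cong; cong₂; subst; subst₂; module ≡-Reasoning)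
open import Function.Bundles using (Equivalence)
open import Algebra.Properties.CommutativeSemigroup ℕₚ.+-commutativeSemigroup using (x∙yz≈y∙xz)

private
  variable
    N : ℕ

∈-transport : ∀ {M} {p : Subset N} {q : Subset M} {x y}
  → lookup p x ≡ lookup q y → x ∈ p → y ∈ q
∈-transport {q = q} {y = y} e x∈p = lookup⇒[]= y q (trans (sym e) ([]=⇒lookup x∈p))

lookup≡outside⇒∉ : ∀ {p : Subset N} {x} → lookup p x ≡ outside → x ∉ p
lookup≡outside⇒∉ eq x∈p with trans (sym ([]=⇒lookup x∈p)) eq
... | ()

∣p++q∣ : ∀ {M} (p : Subset N) (q : Subset M) → ∣ p ++ q ∣ ≡ ∣ p ∣ + ∣ q ∣
∣p++q∣ []            q = refl
∣p++q∣ (inside  ∷ p) q = cong suc (∣p++q∣ p q)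
∣p++q∣ (outside ∷ p) q = ∣p++q∣ p q

∣p∪q∣≤∣p∣+∣q∣ : (p q : Subset N) → ∣ p ∪ q ∣ ≤ ∣ p ∣ + ∣ q ∣
∣p∪q∣≤∣p∣+∣q∣ []            []            = z≤n
∣p∪q∣≤∣p∣+∣q∣ (outside ∷ p) (outside ∷ q) = ∣p∪q∣≤∣p∣+∣q∣ p q
∣p∪q∣≤∣p∣+∣q∣ (inside  ∷ p) (outside ∷ q) = s≤s (∣p∪q∣≤∣p∣+∣q∣ p q)
∣p∪q∣≤∣p∣+∣q∣ (outside ∷ p) (inside  ∷ q) =
  ℕₚ.≤-trans (s≤s (∣p∪q∣≤∣p∣+∣q∣ p q)) (ℕₚ.≤-reflexive (sym (ℕₚ.+-suc ∣ p ∣ ∣ q ∣)))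
∣p∪q∣≤∣p∣+∣q∣ (inside  ∷ p) (inside  ∷ q) =
  s≤s (ℕₚ.≤-trans (∣p∪q∣≤∣p∣+∣q∣ p q) (ℕₚ.+-monoʳ-≤ ∣ p ∣ (ℕₚ.n≤1+n ∣ q ∣)))

∣p∪⁅x⁆∣ : ∀ {p : Subset N} {x} → x ∉ p → ∣ p ∪ ⁅ x ⁆ ∣ ≡ suc ∣ p ∣
∣p∪⁅x⁆∣ {p = inside  ∷ p} {zero}  x∉p = ⊥-elim (x∉p here)
∣p∪⁅x⁆∣ {p = outside ∷ p} {zero}  _   = cong (λ q → suc ∣ q ∣) (∪-identityʳ p)
∣p∪⁅x⁆∣ {p = inside  ∷ p} {suc x} x∉p = cong suc (∣p∪⁅x⁆∣ (λ x∈p → x∉p (there x∈p)))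
∣p∪⁅x⁆∣ {p = outside ∷ p} {suc x} x∉p = ∣p∪⁅x⁆∣ (λ x∈p → x∉p (there x∈p))

x∈p-y⇒x≢y : ∀ {p : Subset N} {x y} → x ∈ p - y → x ≢ y
x∈p-y⇒x≢y {p = _ ∷ p} {zero}  {zero}  ()
x∈p-y⇒x≢y {p = _ ∷ p} {suc x} {suc y} (there x∈p-y) refl = x∈p-y⇒x≢y {p = p} x∈p-y refl

lookup-concat : ∀ {k M} {A : Set} (vs : Vec (Vec A M) k) i x
  → lookup (concat vs) (combine i x) ≡ lookup (lookup vs i) x
lookup-concat (u ∷ vs) zero    x = lookup-++ˡ u (concat vs) x
lookup-concat (u ∷ vs) (suc i) x =
  trans (lookup-++ʳ u (concat vs) (combine i x)) (lookup-concat vs i x)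

sum-tabulate-mono : ∀ {f g : Fin N → ℕ} → (∀ i → f i ≤ g i) → sum (tabulate f) ≤ sum (tabulate g)
sum-tabulate-mono {zero}  _   = z≤n
sum-tabulate-mono {suc N} f≤g = ℕₚ.+-mono-≤ (f≤g zero) (sum-tabulate-mono (λ i → f≤g (suc i)))

sum-tabulate-const : ∀ N c → sum (tabulate {n = N} (λ _ → c)) ≡ N * c
sum-tabulate-const zero    c = refl
sum-tabulate-const (suc N) c = cong (c +_) (sum-tabulate-const N c)

sum-tabulate-select : ∀ (A : Subset N) x y
  → sum (tabulate (λ i → if lookup A i then x else y)) ≡ ∣ A ∣ * x + ∣ ∁ A ∣ * y
sum-tabulate-select []            x y = refl
sum-tabulate-select (inside  ∷ A) x y =
  trans (cong (x +_) (sum-tabulate-select A x y)) (sym (ℕₚ.+-assoc x _ _))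
sum-tabulate-select (outside ∷ A) x y =
  trans (cong (y +_) (sum-tabulate-select A x y)) (x∙yz≈y∙xz y (∣ A ∣ * x) _)

∣concat∣ : ∀ {M} (F : Fin N → Subset M) → ∣ concat (tabulate F) ∣ ≡ sum (tabulate (λ i → ∣ F i ∣))
∣concat∣ {zero}  F = refl
∣concat∣ {suc N} F = trans (∣p++q∣ (F zero) _) (cong (∣ F zero ∣ +_) (∣concat∣ (λ i → F (suc i))))

module Blocks {n m : ℕ} where

  blocks : (Fin n → Subset m) → Subset (n * m)
  blocks F = concat (tabulate F)

  slice : Subset (n * m) → Fin n → Subset m
  slice D i = tabulate (λ x → lookup D (combine i x))

  split : (p : Fin (n * m)) → Σ (Fin n) λ i → Σ (Fin m) λ x → p ≡ combine i x
  split p = proj₁ (remQuot {n} m p) , proj₂ (remQuot {n} m p) , sym (combine-remQuot {n} m p)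

  lookup-blocks : ∀ F i x → lookup (blocks F) (combine i x) ≡ lookup (F i) x
  lookup-blocks F i x = trans (lookup-concat (tabulate F) i x) (cong (λ u → lookup u x) (lookup∘tabulate F i))

  lookup-slice : ∀ D i x → lookup (slice D i) x ≡ lookup D (combine i x)
  lookup-slice D i x = lookup∘tabulate _ x

  ∈-blocks⁺ : ∀ {F i x} → x ∈ F i → combine i x ∈ blocks F
  ∈-blocks⁺ {F} {i} {x} = ∈-transport (sym (lookup-blocks F i x))

  ∈-blocks⁻ : ∀ {F i x} → combine i x ∈ blocks F → x ∈ F i
  ∈-blocks⁻ {F} {i} {x} = ∈-transport (lookup-blocks F i x)

  ∈-slice⁺ : ∀ {D i x} → combine i x ∈ D → x ∈ slice D i
  ∈-slice⁺ {D} {i} {x} = ∈-transport (sym (lookup-slice D i x))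

  ∈-slice⁻ : ∀ {D i x} → x ∈ slice D i → combine i x ∈ D
  ∈-slice⁻ {D} {i} {x} = ∈-transport (lookup-slice D i x)

  blocks-slice : ∀ D → blocks (slice D) ≡ D
  blocks-slice D = begin
    blocks (slice D)                      ≡⟨ tabulate∘lookup _ ⟨
    tabulate (lookup (blocks (slice D)))  ≡⟨ tabulate-cong same ⟩
    tabulate (lookup D)                   ≡⟨ tabulate∘lookup D ⟩
    D                                     ∎
    where
    open ≡-Reasoning
    same : ∀ p → lookup (blocks (slice D)) p ≡ lookup D p
    same p with split p
    ... | i , x , refl = trans (lookup-blocks (slice D) i x) (lookup-slice D i x)

  ∣blocks∣ : ∀ F → ∣ blocks F ∣ ≡ sum (tabulate (λ i → ∣ F i ∣))
  ∣blocks∣ = ∣concat∣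

  ∣D∣≡Σ∣slice∣ : ∀ D → ∣ D ∣ ≡ sum (tabulate (λ i → ∣ slice D i ∣))
  ∣D∣≡Σ∣slice∣ D = trans (cong ∣_∣ (sym (blocks-slice D))) (∣blocks∣ (slice D))

module GraphFacts {N : ℕ} (Gr : Graph N) where

  AdjacencyDecidable : Set
  AdjacencyDecidable = ∀ x y → Dec (Adj Gr x y)

  HasNeighbourIn : Subset N → Fin N → Set
  HasNeighbourIn S x = Σ (Fin N) λ y → y ∈ S × Adj Gr x y

  DominatesIn : Subset N → Subset N → Set
  DominatesIn I Q = ∀ x → x ∈ Q → x ∈ I ⊎ HasNeighbourIn I x

  private
    ¬¬-∀ : ∀ {k} {P : Fin k → Set} → (∀ i → ¬ ¬ P i) → ¬ ¬ (∀ i → P i)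
    ¬¬-∀ {zero}  _  ¬all = ¬all (λ ())
    ¬¬-∀ {suc k} ¬¬P ¬all = ¬¬P zero λ p₀ →
      ¬¬-∀ (λ i → ¬¬P (suc i)) λ ps → ¬all λ { zero → p₀ ; (suc i) → ps i }

  -- When proving a decidable statement, adjacency may be assumed decidable:
  -- there are only finitely many pairs, so this holds up to double negation.
  withDecidableAdjacency : ∀ {Goal : Set} → Dec Goal → (AdjacencyDecidable → Goal) → Goal
  withDecidableAdjacency goal? prove = decidable-stable goal? λ ¬goal →
    ¬¬-∀ (λ x → ¬¬-∀ (λ y → ¬¬-excluded-middle)) (λ dec → ¬goal (prove dec))

  hasNeighbourIn? : AdjacencyDecidable → ∀ S x → Dec (HasNeighbourIn S x)
  hasNeighbourIn? dec S x = any? (λ y → (y ∈? S) ×-dec dec x y)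

  dominated? : AdjacencyDecidable → ∀ S x → Dec (x ∈ S ⊎ HasNeighbourIn S x)
  dominated? dec S x = (x ∈? S) ⊎-dec hasNeighbourIn? dec S x

  dominated-mono : ∀ {I J x} → I ⊆ J → x ∈ I ⊎ HasNeighbourIn I x → x ∈ J ⊎ HasNeighbourIn J x
  dominated-mono I⊆J (inj₁ x∈I)           = inj₁ (I⊆J x∈I)
  dominated-mono I⊆J (inj₂ (y , y∈I , a)) = inj₂ (y , I⊆J y∈I , a)

  independent-∪ : ∀ {S T} → Independent Gr S → Independent Gr T
    → (∀ x y → x ∈ S → y ∈ T → ¬ Adj Gr x y) → Independent Gr (S ∪ T)
  independent-∪ {S} {T} indS indT S≁T x y x∈ y∈ x~y with x∈p∪q⁻ S T x∈ | x∈p∪q⁻ S T y∈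
  ... | inj₁ x∈S | inj₁ y∈S = indS x y x∈S y∈S x~y
  ... | inj₁ x∈S | inj₂ y∈T = S≁T x y x∈S y∈T x~y
  ... | inj₂ x∈T | inj₁ y∈S = S≁T y x y∈S x∈T (adjSym Gr x~y)
  ... | inj₂ x∈T | inj₂ y∈T = indT x y x∈T y∈T x~y

  independent-∪⁅⁆ : ∀ {S z} → Independent Gr S → (∀ y → y ∈ S → ¬ Adj Gr z y)
    → Independent Gr (S ∪ ⁅ z ⁆)
  independent-∪⁅⁆ {S} {z} indS z≁S = independent-∪ indS ind⁅z⁆ λ x y x∈S y∈z x~y →
    z≁S x x∈S (adjSym Gr (subst (Adj Gr x) (x∈⁅y⁆⇒x≡y z y∈z) x~y))
    where
    ind⁅z⁆ : Independent Gr ⁅ z ⁆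
    ind⁅z⁆ x y x∈z y∈z x~y =
      adjIrrefl Gr (subst (Adj Gr x) (trans (x∈⁅y⁆⇒x≡y z y∈z) (sym (x∈⁅y⁆⇒x≡y z x∈z))) x~y)

  -- A maximum independent set is dominating: an undominated vertex could be added.
  maximumIndependent⇒dominating : AdjacencyDecidable → ∀ {A} → Independent Gr A
    → (∀ S → Independent Gr S → ∣ S ∣ ≤ ∣ A ∣) → Dominating Gr A
  maximumIndependent⇒dominating dec {A} indA maxA x x∉A with hasNeighbourIn? dec A x
  ... | yes nb  = nb
  ... | no  ¬nb = ⊥-elim (ℕₚ.1+n≰n (subst (_≤ ∣ A ∣) (∣p∪⁅x⁆∣ x∉A) (maxA _ indA∪x)))
    where
    indA∪x : Independent Gr (A ∪ ⁅ x ⁆)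
    indA∪x = independent-∪⁅⁆ indA (λ y y∈A x~y → ¬nb (y , y∈A , x~y))

  greedyIndependent : AdjacencyDecidable → ∀ Q (xs : L.List (Fin N))
    → Σ (Subset N) λ I → I ⊆ Q × Independent Gr I
        × (∀ x → x ∈ᴸ xs → x ∈ Q → x ∈ I ⊎ HasNeighbourIn I x)
  greedyIndependent dec Q L.[] =
    ∅ , (λ x∈∅ → ⊥-elim (∉⊥ x∈∅)) , (λ x _ x∈∅ → ⊥-elim (∉⊥ x∈∅)) , λ _ ()
  greedyIndependent dec Q (z L.∷ xs) with greedyIndependent dec Q xs
  ... | I , I⊆Q , indI , domI with dominated? dec I z | z ∈? Q
  ...   | yes z-dom | _ = I , I⊆Q , indI , λ
    { x (Any.here refl) _   → z-dom
    ; x (Any.there x∈xs) x∈Q → domI x x∈xs x∈Q }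
  ...   | no _ | no z∉Q = I , I⊆Q , indI , λ
    { x (Any.here refl) z∈Q → ⊥-elim (z∉Q z∈Q)
    ; x (Any.there x∈xs) x∈Q → domI x x∈xs x∈Q }
  ...   | no z-undom | yes z∈Q = I ∪ ⁅ z ⁆ , I∪z⊆Q , indI∪z , λ
    { x (Any.here refl) _   → inj₁ (q⊆p∪q I ⁅ z ⁆ (x∈⁅x⁆ z))
    ; x (Any.there x∈xs) x∈Q → dominated-mono (p⊆p∪q ⁅ z ⁆) (domI x x∈xs x∈Q) }
    where
    I∪z⊆Q : I ∪ ⁅ z ⁆ ⊆ Q
    I∪z⊆Q {x} x∈ with x∈p∪q⁻ I ⁅ z ⁆ x∈
    ... | inj₁ x∈I = I⊆Q x∈I
    ... | inj₂ x∈z = subst (_∈ Q) (sym (x∈⁅y⁆⇒x≡y z x∈z)) z∈Q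
    indI∪z : Independent Gr (I ∪ ⁅ z ⁆)
    indI∪z = independent-∪⁅⁆ indI (λ y y∈I z~y → z-undom (inj₂ (y , y∈I , z~y)))

  maximalIndependentSubset : AdjacencyDecidable → ∀ Q
    → Σ (Subset N) λ I → I ⊆ Q × Independent Gr I × DominatesIn I Q
  maximalIndependentSubset dec Q with greedyIndependent dec Q (L.allFin N)
  ... | I , I⊆Q , indI , domI = I , I⊆Q , indI , λ x → domI x (∈-allFin x)

  ids-or-add : AdjacencyDecidable → ∀ {S v} → Independent Gr S
    → (∀ x → x ∉ S → x ≢ v → HasNeighbourIn S x)
    → IsIDS Gr S ⊎ (v ∉ S × IsIDS Gr (S ∪ ⁅ v ⁆))
  ids-or-add dec {S} {v} indS domS with dominated? dec S v
  ... | yes v-dom = inj₁ (indS , dom)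
    where
    dom : Dominating Gr S
    dom x x∉S with x ≟ v
    ... | no  x≢v  = domS x x∉S x≢v
    ... | yes refl = [ (λ v∈S → ⊥-elim (x∉S v∈S)) , id ]′ v-dom
  ... | no v-undom = inj₂ (v∉S , indS∪v , dom)
    where
    v∉S : v ∉ S
    v∉S v∈S = v-undom (inj₁ v∈S)
    indS∪v : Independent Gr (S ∪ ⁅ v ⁆)
    indS∪v = independent-∪⁅⁆ indS (λ y y∈S v~y → v-undom (inj₂ (y , y∈S , v~y)))
    dom : Dominating Gr (S ∪ ⁅ v ⁆)
    dom x x∉ with domS x (λ x∈S → x∉ (p⊆p∪q ⁅ v ⁆ x∈S)) (λ { refl → x∉ (q⊆p∪q S ⁅ v ⁆ (x∈⁅x⁆ v)) })
    ... | y , y∈S , x~y = y , p⊆p∪q ⁅ v ⁆ y∈S , x~y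

module RootedProduct {n m : ℕ} (G : Graph n) (H : Graph m) (v : Fin m) where

  open Blocks {n} {m}
  module GF = GraphFacts G
  module HF = GraphFacts H

  GH : Graph (n * m)
  GH = rootedProduct G H v

  private
    AdjDecoded : Fin n × Fin m → Fin n × Fin m → Set
    AdjDecoded r s = ((proj₁ r ≡ proj₁ s) × Adj H (proj₂ r) (proj₂ s))
                   ⊎ ((proj₂ r ≡ v) × (proj₂ s ≡ v) × Adj G (proj₁ r) (proj₁ s))

  adj-within : ∀ {i x y} → Adj H x y → Adj GH (combine i x) (combine i y)
  adj-within {i} {x} {y} x~y =
    subst₂ AdjDecoded (sym (remQuot-combine i x)) (sym (remQuot-combine i y)) (inj₁ (refl , x~y))

  adj-roots : ∀ {i j} → Adj G i j → Adj GH (combine i v) (combine j v)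
  adj-roots {i} {j} i~j =
    subst₂ AdjDecoded (sym (remQuot-combine i v)) (sym (remQuot-combine j v)) (inj₂ (refl , refl , i~j))

  adj-cases : ∀ {i j x y} → Adj GH (combine i x) (combine j y)
    → (i ≡ j × Adj H x y) ⊎ (x ≡ v × y ≡ v × Adj G i j)
  adj-cases {i} {j} {x} {y} = subst₂ AdjDecoded (remQuot-combine i x) (remQuot-combine j y)

  blocks-independent : ∀ {F} → (∀ i → Independent H (F i))
    → (∀ i j → v ∈ F i → v ∈ F j → ¬ Adj G i j) → Independent GH (blocks F)
  blocks-independent indF roots p q p∈ q∈ p~q with split p | split q
  ... | i , x , refl | j , y , refl with adj-cases p~q
  ... | inj₁ (refl , x~y)        = indF i x y (∈-blocks⁻ p∈) (∈-blocks⁻ q∈) x~y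
  ... | inj₂ (refl , refl , i~j) = roots i j (∈-blocks⁻ p∈) (∈-blocks⁻ q∈) i~j

  blocks-dominating : ∀ {F}
    → (∀ i x → x ∉ F i → HF.HasNeighbourIn (F i) x
                          ⊎ (x ≡ v × Σ (Fin n) λ j → v ∈ F j × Adj G i j))
    → Dominating GH (blocks F)
  blocks-dominating domF p p∉ with split p
  ... | i , x , refl with domF i x (λ x∈ → p∉ (∈-blocks⁺ x∈))
  ... | inj₁ (y , y∈ , x~y)         = combine i y , ∈-blocks⁺ y∈ , adj-within x~y
  ... | inj₂ (refl , j , v∈ , i~j) = combine j v , ∈-blocks⁺ v∈ , adj-roots i~j

  slice-independent : ∀ {D} → Independent GH D → ∀ i → Independent H (slice D i)
  slice-independent indD i x y x∈ y∈ x~y = indD _ _ (∈-slice⁻ x∈) (∈-slice⁻ y∈) (adj-within x~y)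

  -- Only the root of a copy can be dominated from another copy.
  slice-dominates-off-root : ∀ {D} → Dominating GH D
    → ∀ i x → x ∉ slice D i → x ≢ v → HF.HasNeighbourIn (slice D i) x
  slice-dominates-off-root domD i x x∉ x≢v with domD (combine i x) (λ p∈ → x∉ (∈-slice⁺ p∈))
  ... | q , q∈ , p~q with split q
  ... | j , y , refl with adj-cases p~q
  ... | inj₁ (refl , x~y) = y , ∈-slice⁺ q∈ , x~y
  ... | inj₂ (x≡v , _)    = ⊥-elim (x≢v x≡v)

  -- (i), lower bound: if v lies in no i(H)-set, every slice of an IDS of G ∘ H has at
  -- least i(H) vertices.  Otherwise the slice plus v would be an i(H)-set containing v.
  slice-lower-bound : ∀ {iH} → IsIndepDomNumber H iH → (∀ S → IsISet H iH S → v ∉ S)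
    → ∀ {D} → IsIDS GH D → ∀ i → iH ≤ ∣ slice D i ∣
  slice-lower-bound {iH} (_ , iH-min) v-avoided {D} (indD , domD) i =
    HF.withDecidableAdjacency (iH ≤? ∣ slice D i ∣) bound
    where
    bound : HF.AdjacencyDecidable → iH ≤ ∣ slice D i ∣
    bound decH with HF.ids-or-add decH (slice-independent indD i) (slice-dominates-off-root domD i)
    ... | inj₁ idsᵢ = iH-min _ idsᵢ
    ... | inj₂ (v∉Dᵢ , idsᵢ∪v) = ℕₚ.≤-pred (ℕₚ.≤∧≢⇒< iH≤ iH≢)
      where
      size : ∣ slice D i ∪ ⁅ v ⁆ ∣ ≡ suc ∣ slice D i ∣
      size = ∣p∪⁅x⁆∣ v∉Dᵢ
      iH≤ : iH ≤ suc ∣ slice D i ∣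
      iH≤ = subst (iH ≤_) size (iH-min _ idsᵢ∪v)
      iH≢ : iH ≢ suc ∣ slice D i ∣
      iH≢ eq = v-avoided _ (idsᵢ∪v , trans size (sym eq)) (q⊆p∪q _ ⁅ v ⁆ (x∈⁅x⁆ v))

  theorem7-i : ∀ {iH} → IsIndepDomNumber H iH → (∀ S → IsISet H iH S → v ∉ S)
    → IsIndepDomNumber GH (n * iH)
  theorem7-i {iH} iH-number@((S₀ , S₀-iset@((indS₀ , domS₀) , ∣S₀∣≡iH)) , _) v-avoided =
    (D₀ , ids , size) , lower
    where
    D₀ : Subset (n * m)
    D₀ = blocks (λ _ → S₀)
    ids : IsIDS GH D₀
    ids = blocks-independent (λ _ → indS₀) (λ _ _ v∈S₀ _ → ⊥-elim (v-avoided S₀ S₀-iset v∈S₀))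
        , blocks-dominating (λ _ x x∉S₀ → inj₁ (domS₀ x x∉S₀))
    size : ∣ D₀ ∣ ≡ n * iH
    size = trans (∣blocks∣ _) (trans (sum-tabulate-const n ∣ S₀ ∣) (cong (n *_) ∣S₀∣≡iH))
    lower : ∀ D → IsIDS GH D → n * iH ≤ ∣ D ∣
    lower D idsD = begin
      n * iH                               ≡⟨ sum-tabulate-const n iH ⟨
      sum (tabulate {n = n} (λ _ → iH))    ≤⟨ sum-tabulate-mono (slice-lower-bound iH-number v-avoided idsD) ⟩
      sum (tabulate (λ i → ∣ slice D i ∣)) ≡⟨ ∣D∣≡Σ∣slice∣ D ⟨
      ∣ D ∣                                ∎
      where open ℕₚ.≤-Reasoning

  -- T avoids the root, is independent since P has no neighbours in
  -- S - v, and dominates every non-root vertex: one without a neighbour in S - v is a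
  -- private neighbour of v, hence dominated by I.
  module Construction (decH : HF.AdjacencyDecidable)
    (A : Subset n) (indA : Independent G A) (domA : Dominating G A)
    (S : Subset m) (indS : Independent H S) (domS : Dominating H S) (v∈S : v ∈ S)
    (P : Subset m) (P-private : IsPrivateNbhdSet H v S P) where

    private
      maximal : Σ (Subset m) λ I → I ⊆ P - v × Independent H I × HF.DominatesIn I (P - v)
      maximal = HF.maximalIndependentSubset decH (P - v)

    I : Subset m
    I = proj₁ maximal

    I⊆P-v : I ⊆ P - v
    I⊆P-v = proj₁ (proj₂ maximal)

    I-independent : Independent H I
    I-independent = proj₁ (proj₂ (proj₂ maximal))

    I-dominates : HF.DominatesIn I (P - v)
    I-dominates = proj₂ (proj₂ (proj₂ maximal))

    I⊆P : I ⊆ P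
    I⊆P x∈I = p─q⊆p P ⁅ v ⁆ (I⊆P-v x∈I)

    T : Subset m
    T = (S - v) ∪ I

    S-v⊆T : S - v ⊆ T
    S-v⊆T = p⊆p∪q I

    I⊆T : I ⊆ T
    I⊆T = q⊆p∪q (S - v) I

    private-not-adjacent : ∀ {x y} → y ∈ P → x ∈ S → x ≢ v → ¬ Adj H x y
    private-not-adjacent {x} {y} y∈P x∈S x≢v x~y =
      proj₂ (Equivalence.to (P-private y) y∈P) x x∈S x≢v (inj₂ x~y)

    v∉T : v ∉ T
    v∉T v∈T with x∈p∪q⁻ (S - v) I v∈T
    ... | inj₁ v∈S-v = x∈p-y⇒x≢y {p = S} v∈S-v refl
    ... | inj₂ v∈I   = x∈p-y⇒x≢y {p = P} (I⊆P-v v∈I) refl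

    T-independent : Independent H T
    T-independent = HF.independent-∪
      (λ x y x∈ y∈ → indS x y (p─q⊆p S ⁅ v ⁆ x∈) (p─q⊆p S ⁅ v ⁆ y∈))
      I-independent
      (λ x y x∈S-v y∈I →
        private-not-adjacent (I⊆P y∈I) (p─q⊆p S ⁅ v ⁆ x∈S-v) (x∈p-y⇒x≢y {p = S} x∈S-v))

    undominated⇒private : ∀ {x} → x ∉ S → ¬ HF.HasNeighbourIn (S - v) x → x ∈ P
    undominated⇒private {x} x∉S ¬nb = Equivalence.from (P-private x) (x∈N[v] , outside-N[S-v])
      where
      x∈N[v] : InClosedNbhd H v x
      x∈N[v] with domS x x∉S
      ... | y , y∈S , x~y with y ≟ v
      ...   | yes refl = inj₂ (adjSym H x~y)
      ...   | no  y≢v  = ⊥-elim (¬nb (y , x∈p∧x≢y⇒x∈p-y y∈S y≢v , x~y))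
      outside-N[S-v] : ∀ w → w ∈ S → w ≢ v → ¬ InClosedNbhd H w x
      outside-N[S-v] w w∈S w≢v (inj₁ refl) = x∉S w∈S
      outside-N[S-v] w w∈S w≢v (inj₂ w~x)  = ¬nb (w , x∈p∧x≢y⇒x∈p-y w∈S w≢v , adjSym H w~x)

    outside-T⇒outside-S : ∀ {x} → x ∉ T → x ≢ v → x ∉ S
    outside-T⇒outside-S x∉T x≢v x∈S = x∉T (S-v⊆T (x∈p∧x≢y⇒x∈p-y x∈S x≢v))

    T-dominates-off-root : ∀ x → x ∉ T → x ≢ v → HF.HasNeighbourIn T x
    T-dominates-off-root x x∉T x≢v with HF.hasNeighbourIn? decH (S - v) x
    ... | yes (y , y∈ , x~y) = y , S-v⊆T y∈ , x~y
    ... | no ¬nb with I-dominates x (x∈p∧x≢y⇒x∈p-y x∈P x≢v)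
      where
      x∈P : x ∈ P
      x∈P = undominated⇒private (outside-T⇒outside-S x∉T x≢v) ¬nb
    ...   | inj₁ x∈I             = ⊥-elim (x∉T (I⊆T x∈I))
    ...   | inj₂ (y , y∈I , x~y) = y , I⊆T y∈I , x~y

    choose : Bool → Subset m
    choose true  = S
    choose false = T

    D : Subset (n * m)
    D = blocks (λ i → choose (lookup A i))

    -- Roots occur only in copies indexed by the independent set A, and a root outside
    -- them is dominated from a copy indexed by A because A dominates G.
    ids : IsIDS GH D
    ids = blocks-independent (λ i → choose-independent (lookup A i)) roots
        , blocks-dominating (λ i x → dominate i x (lookup A i) refl)
      where
      choose-independent : ∀ b → Independent H (choose b)
      choose-independent true  = indS
      choose-independent false = T-independent
      root-in-A : ∀ i → v ∈ choose (lookup A i) → i ∈ A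
      root-in-A i v∈ with lookup A i in eq
      ... | true  = lookup⇒[]= i A eq
      ... | false = ⊥-elim (v∉T v∈)
      roots : ∀ i j → v ∈ choose (lookup A i) → v ∈ choose (lookup A j) → ¬ Adj G i j
      roots i j v∈ᵢ v∈ⱼ = indA i j (root-in-A i v∈ᵢ) (root-in-A j v∈ⱼ)
      dominate : ∀ i x b → lookup A i ≡ b → x ∉ choose b
        → HF.HasNeighbourIn (choose b) x ⊎ (x ≡ v × Σ (Fin n) λ j → v ∈ choose (lookup A j) × Adj G i j)
      dominate i x true  _  x∉S = inj₁ (domS x x∉S)
      dominate i x false eq x∉T with x ≟ v
      ... | no x≢v   = inj₁ (T-dominates-off-root x x∉T x≢v)
      ... | yes refl with domA i (lookup≡outside⇒∉ eq)
      ...   | j , j∈A , i~j = inj₂ (refl , j , subst (λ b → v ∈ choose b) (sym ([]=⇒lookup j∈A)) v∈S , i~j)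

    size : ∣ D ∣ ≤ ∣ A ∣ * ∣ S ∣ + ∣ ∁ A ∣ * (∣ P ∣ + ∣ S ∣ ∸ 1)
    size = begin
      ∣ D ∣                                               ≡⟨ ∣blocks∣ _ ⟩
      sum (tabulate (λ i → ∣ choose (lookup A i) ∣))       ≤⟨ sum-tabulate-mono (λ i → choose-size (lookup A i)) ⟩
      sum (tabulate (λ i → if lookup A i then ∣ S ∣ else ∣ P ∣ + ∣ S ∣ ∸ 1))
                                                          ≡⟨ sum-tabulate-select A _ _ ⟩
      ∣ A ∣ * ∣ S ∣ + ∣ ∁ A ∣ * (∣ P ∣ + ∣ S ∣ ∸ 1)           ∎
      where
      open ℕₚ.≤-Reasoning
      ∣S-v∣<∣S∣ : ∣ S - v ∣ < ∣ S ∣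
      ∣S-v∣<∣S∣ = x∈p⇒∣p-x∣<∣p∣ v∈S
      ∣T∣-bound : ∣ T ∣ ≤ ∣ P ∣ + ∣ S ∣ ∸ 1
      ∣T∣-bound = begin
        ∣ T ∣                  ≤⟨ ∣p∪q∣≤∣p∣+∣q∣ (S - v) I ⟩
        ∣ S - v ∣ + ∣ I ∣      ≤⟨ ℕₚ.+-monoʳ-≤ ∣ S - v ∣ (p⊆q⇒∣p∣≤∣q∣ I⊆P) ⟩
        ∣ S - v ∣ + ∣ P ∣      ≡⟨ ℕₚ.+-comm ∣ S - v ∣ ∣ P ∣ ⟩
        ∣ P ∣ + ∣ S - v ∣      ≤⟨ ℕₚ.+-monoʳ-≤ ∣ P ∣ (ℕₚ.∸-monoˡ-≤ 1 ∣S-v∣<∣S∣) ⟩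
        ∣ P ∣ + (∣ S ∣ ∸ 1)    ≡⟨ ℕₚ.+-∸-assoc ∣ P ∣ (ℕₚ.≤-trans (s≤s z≤n) ∣S-v∣<∣S∣) ⟨
        ∣ P ∣ + ∣ S ∣ ∸ 1      ∎
      choose-size : ∀ b → ∣ choose b ∣ ≤ (if b then ∣ S ∣ else ∣ P ∣ + ∣ S ∣ ∸ 1)
      choose-size true  = ℕₚ.≤-refl
      choose-size false = ∣T∣-bound

  theorem7-ii : ∀ {iH} → (∀ S → IsISet H iH S → v ∈ S)
    → ∀ a → IsIndepNumber G a
    → ∀ S → IsISet H iH S
    → ∀ P → IsPrivateNbhdSet H v S P
    → ∀ k → IsIndepDomNumber GH k
    → k ≤ a * iH + (n ∸ a) * (∣ P ∣ + iH ∸ 1)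
  theorem7-ii {iH} v-everywhere a ((A , indA , ∣A∣≡a) , a-max)
              S S-iset@((indS , domS) , ∣S∣≡iH) P P-private k (_ , k-min) =
    GF.withDecidableAdjacency (k ≤? _) λ decG →
    HF.withDecidableAdjacency (k ≤? _) λ decH →
    let open Construction decH A indA (domA decG) S indS domS (v-everywhere S S-iset) P P-private
    in ℕₚ.≤-trans (k-min D ids) (subst (∣ D ∣ ≤_) bound-in-parameters size)
    where
    domA : GF.AdjacencyDecidable → Dominating G A
    domA decG = GF.maximumIndependent⇒dominating decG indA
      (λ T indT → subst (∣ T ∣ ≤_) (sym ∣A∣≡a) (a-max T indT))
    bound-in-parameters : ∣ A ∣ * ∣ S ∣ + ∣ ∁ A ∣ * (∣ P ∣ + ∣ S ∣ ∸ 1)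
                        ≡ a * iH + (n ∸ a) * (∣ P ∣ + iH ∸ 1)
    bound-in-parameters =
      trans (cong (λ c → ∣ A ∣ * ∣ S ∣ + c * (∣ P ∣ + ∣ S ∣ ∸ 1)) (∣∁p∣≡n∸∣p∣ A))
            (cong₂ (λ α s → α * s + (n ∸ α) * (∣ P ∣ + s ∸ 1)) ∣A∣≡a ∣S∣≡iH)

mainTheorem7 : ∀ {n m} → 2 ≤ n → 2 ≤ m → (G : Graph n) → (H : Graph m) → (v : Fin m)
    → (iH : ℕ) → IsIndepDomNumber H iH
    → ((∀ S → IsISet H iH S → v ∉ S)
         → IsIndepDomNumber (rootedProduct G H v) (n * iH))
      × ((∀ S → IsISet H iH S → v ∈ S)
         → ∀ (a : ℕ) → IsIndepNumber G a
         → ∀ (S : Subset m) → IsISet H iH S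
         → ∀ (P : Subset m) → IsPrivateNbhdSet H v S P
         → ∀ (k : ℕ) → IsIndepDomNumber (rootedProduct G H v) k
         → k ≤ a * iH + (n ∸ a) * (∣ P ∣ + iH ∸ 1))
mainTheorem7 _ _ G H v iH iH-number =
  theorem7-i iH-number , theorem7-ii
  where open RootedProduct G H v
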